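{- Let $n\ge3$ and let real numbers $x_{i,j}$, $i,j\in\{1,\ldots,n\}$, satisfy $$x_{i,j}x_{k,\ell}=x_{i,k}x_{j,\ell}+x_{i,\ell}x_{k,j}\quad(i\le k\le j\le \ell),\qquad x_{i,i}=0,\qquad x_{i,i+1}=1.$$ Put $c_i=x_{i-1,i+1}$. Then for all indices $i\le j$ with $1\le i-1$ and $j+1\le n$, $$x_{i-1,j+1}=K_{j-i+1}(c_i,\ldots,c_j).$$
   Context: The continuant $K_m(c_1,\ldots,c_m)$ is the determinant of the $m\times m$ tridiagonal matrix with diagonal entries $c_1,\ldots,c_m$, all entries immediately above and below the diagonal equal to $1$, and all other entries $0$. -}

module Defs where

open import Algebra.Bundles using (CommutativeRing)
open import Data.Nat using (ℕ; zero; suc; _≟_)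
open import Data.Fin using (Fin; zero; suc; toℕ; punchIn)
open import Data.Bool using (if_then_else_)
open import Relation.Nullary using (does)

module _ {c ℓ} (R : CommutativeRing c ℓ) where
  open CommutativeRing R using (Carrier; 0#; 1#; _-_; _*_)

  altSum : (k : ℕ) → (Fin k → Carrier) → Carrier
  altSum zero    f = 0#
  altSum (suc k) f = f zero - altSum k (λ j → f (suc j))

  det : (m : ℕ) → (Fin m → Fin m → Carrier) → Carrier
  det zero    M = 1#
  det (suc m) M =
    altSum (suc m) (λ j → M zero j * det m (λ r s → M (suc r) (punchIn j s)))

  tridiag : (m : ℕ) → (Fin m → Carrier) → Fin m → Fin m → Carrier
  tridiag m cs r s =
    if does (toℕ r ≟ toℕ s) then cs r
    else if does (suc (toℕ r) ≟ toℕ s) then 1#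
    else if does (toℕ r ≟ suc (toℕ s)) then 1#
    else 0#

  -- continuant K_m(c_1,…,c_m) (indices shifted to Fin m = {0,…,m-1})
  K : (m : ℕ) → (Fin m → Carrier) → Carrier
  K m cs = det m (tridiag m cs)

-- The Plücker relation with (i, k, j, l) = (a, a+1, a+2, b), together with
-- x a (a+1) = x (a+1) (a+2) = 1, gives  x a b = c_a · x (a+1) b − x (a+2) b.
-- Expanding a tridiagonal determinant along its first row gives the same
-- three-term recurrence  K(c₁,…,c_m) = c₁ K(c₂,…,c_m) − K(c₃,…,c_m)  for
-- continuants, so induction on b − a identifies x a b with a continuant.
module Submission where

open import Defs
open import Algebra.Bundles using (CommutativeRing)
open import Data.Nat using (ℕ; zero; suc; z≤n; s≤s; _≟_)
  renaming (_+_ to _+ℕ_; _∸_ to _∸ℕ_; _≤_ to _≤ℕ_)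
import Data.Nat.Properties as ℕₚ
open import Data.Fin using (Fin; zero; suc; toℕ; punchIn)
open import Data.Bool using (true; false)
open import Relation.Nullary using (does)
open import Function using (_∘_)
open import Relation.Binary.PropositionalEquality as ≡ using (_≡_)
import Algebra.Properties.Ring as RingProperties
import Relation.Binary.Reasoning.Setoid as SetoidReasoning

module Determinant {r ℓ} (R : CommutativeRing r ℓ) where
  open CommutativeRing R hiding (zero)
  open RingProperties ring using (-0#≈0#)
  open SetoidReasoning setoid

  -‿cong₂ : ∀ {x y u v} → x ≈ y → u ≈ v → x - u ≈ y - v
  -‿cong₂ x≈y u≈v = +-cong x≈y (-‿cong u≈v)

  x-0#≈x : ∀ x → x - 0# ≈ x
  x-0#≈x x = trans (+-congˡ -0#≈0#) (+-identityʳ x)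

  x≈y+z⇒z≈x-y : ∀ {x y z} → x ≈ y + z → z ≈ x - y
  x≈y+z⇒z≈x-y {x} {y} {z} x≈y+z = begin
    z             ≈⟨ sym (+-identityʳ z) ⟩
    z + 0#        ≈⟨ +-congˡ (sym (-‿inverseʳ y)) ⟩
    z + (y - y)   ≈⟨ sym (+-assoc z y (- y)) ⟩
    (z + y) - y   ≈⟨ -‿cong₂ (+-comm z y) refl ⟩
    (y + z) - y   ≈⟨ -‿cong₂ (sym x≈y+z) refl ⟩
    x - y         ∎

  minor : ∀ {m} → (Fin (suc m) → Fin (suc m) → Carrier) → Fin (suc m) → Fin m → Fin m → Carrier
  minor M j r s = M (suc r) (punchIn j s)

  altSum-cong : ∀ k {f g : Fin k → Carrier} → (∀ j → f j ≈ g j) → altSum R k f ≈ altSum R k g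
  altSum-cong zero    f≈g = refl
  altSum-cong (suc k) f≈g = -‿cong₂ (f≈g zero) (altSum-cong k (f≈g ∘ suc))

  altSum-zeros : ∀ k {f : Fin k → Carrier} → (∀ j → f j ≈ 0#) → altSum R k f ≈ 0#
  altSum-zeros zero    f≈0 = refl
  altSum-zeros (suc k) f≈0 =
    trans (-‿cong₂ (f≈0 zero) (altSum-zeros k (f≈0 ∘ suc))) (x-0#≈x 0#)

  det-cong : ∀ m {M N : Fin m → Fin m → Carrier} → (∀ r s → M r s ≈ N r s) → det R m M ≈ det R m N
  det-cong zero    M≈N = refl
  det-cong (suc m) M≈N = altSum-cong (suc m) λ j →
    *-cong (M≈N zero j) (det-cong m λ r s → M≈N (suc r) (punchIn j s))

  det-zeroColumn : ∀ m (M : Fin (suc m) → Fin (suc m) → Carrier) → (∀ r → M r zero ≈ 0#) →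
                   det R (suc m) M ≈ 0#
  laplaceTerm-zeroColumn : ∀ m (M : Fin (suc m) → Fin (suc m) → Carrier) → (∀ r → M r zero ≈ 0#) →
                           ∀ j → M zero j * det R m (minor M j) ≈ 0#

  det-zeroColumn m M col≈0 = altSum-zeros (suc m) (laplaceTerm-zeroColumn m M col≈0)

  laplaceTerm-zeroColumn m       M col≈0 zero    = trans (*-congʳ (col≈0 zero)) (zeroˡ _)
  laplaceTerm-zeroColumn (suc m) M col≈0 (suc j) =
    trans (*-congˡ (det-zeroColumn m (minor M (suc j)) (col≈0 ∘ suc))) (zeroʳ _)

module Continuant {r ℓ} (R : CommutativeRing r ℓ) where
  open CommutativeRing R hiding (zero)
  open Determinant R
  open SetoidReasoning setoid

  K-cong : ∀ m {cs ds : Fin m → Carrier} → (∀ t → cs t ≈ ds t) → K R m cs ≈ K R m ds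
  K-cong m {cs} {ds} cs≈ds = det-cong m tridiag-cong
    where
    tridiag-cong : ∀ r s → tridiag R m cs r s ≈ tridiag R m ds r s
    tridiag-cong r s with does (toℕ r ≟ toℕ s)
    ... | true  = cs≈ds r
    ... | false = refl

  K-one : ∀ (cs : Fin 1 → Carrier) → K R 1 cs ≈ cs zero
  K-one cs = trans (x-0#≈x _) (*-identityʳ _)

  det-tridiag-minor₁ : ∀ m (cs : Fin (suc (suc m)) → Carrier) →
                       det R (suc m) (minor (tridiag R (suc (suc m)) cs) (suc zero)) ≈ K R m (λ t → cs (suc (suc t)))
  det-tridiag-minor₁ zero    cs = trans (x-0#≈x _) (*-identityˡ 1#)
  det-tridiag-minor₁ (suc m) cs = begin
    1# * K R (suc m) (λ t → cs (suc (suc t))) - altSum R (suc m) (λ j → N zero (suc j) * det R (suc m) (minor N (suc j)))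
      ≈⟨ -‿cong₂ (*-identityˡ _) (altSum-zeros (suc m) otherTerm≈0) ⟩
    K R (suc m) (λ t → cs (suc (suc t))) - 0#
      ≈⟨ x-0#≈x _ ⟩
    K R (suc m) (λ t → cs (suc (suc t))) ∎
    where
    N : Fin (suc (suc m)) → Fin (suc (suc m)) → Carrier
    N = minor (tridiag R (suc (suc (suc m))) cs) (suc zero)

    otherTerm≈0 : ∀ j → N zero (suc j) * det R (suc m) (minor N (suc j)) ≈ 0#
    -- below its first row, column 0 of a tridiagonal matrix vanishes
    otherTerm≈0 zero    = trans (*-congˡ (det-zeroColumn m (minor N (suc zero)) λ _ → refl)) (zeroʳ _)
    otherTerm≈0 (suc j) = zeroˡ _

  K-recurrence : ∀ m (cs : Fin (suc (suc m)) → Carrier) →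
                 K R (suc (suc m)) cs ≈ cs zero * K R (suc m) (λ t → cs (suc t)) - K R m (λ t → cs (suc (suc t)))
  K-recurrence m cs = -‿cong₂ refl (begin
    1# * det R (suc m) (minor (tridiag R (suc (suc m)) cs) (suc zero)) - altSum R m _
      ≈⟨ -‿cong₂ (*-identityˡ _) (altSum-zeros m λ _ → zeroˡ _) ⟩
    det R (suc m) (minor (tridiag R (suc (suc m)) cs) (suc zero)) - 0#
      ≈⟨ x-0#≈x _ ⟩
    det R (suc m) (minor (tridiag R (suc (suc m)) cs) (suc zero))
      ≈⟨ det-tridiag-minor₁ m cs ⟩
    K R m (λ t → cs (suc (suc t))) ∎)

  K-recurrence-window : ∀ m (c : ℕ → Carrier) a →
    K R (suc (suc m)) (λ t → c (a +ℕ toℕ t))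
      ≈ c a * K R (suc m) (λ t → c (suc a +ℕ toℕ t)) - K R m (λ t → c (suc (suc a) +ℕ toℕ t))
  K-recurrence-window m c a = trans (K-recurrence m (λ t → c (a +ℕ toℕ t))) (-‿cong₂
    (*-cong (reflexive (≡.cong c (ℕₚ.+-identityʳ a))) (K-cong (suc m) λ t → reflexive (≡.cong c (ℕₚ.+-suc a (toℕ t)))))
    (K-cong m λ t → reflexive (≡.cong c (≡.trans (ℕₚ.+-suc a (suc (toℕ t))) (≡.cong suc (ℕₚ.+-suc a (toℕ t)))))))

module PlückerSequence {r ℓ} (R : CommutativeRing r ℓ) where
  open CommutativeRing R
  open Determinant R
  open Continuant R
  open SetoidReasoning setoid

  module _ (n : ℕ) (x : ℕ → ℕ → Carrier)
    (plücker : ∀ i k j l → 1 ≤ℕ i → i ≤ℕ k → k ≤ℕ j → j ≤ℕ l → l ≤ℕ n →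
               x i j * x k l ≈ x i k * x j l + x i l * x k j)
    (x-adjacent≈1 : ∀ i → 1 ≤ℕ i → i +ℕ 1 ≤ℕ n → x i (i +ℕ 1) ≈ 1#)
    where
    -- c a is the paper's c_{a+1} = x_{a,a+2}
    c : ℕ → Carrier
    c a = x a (suc (suc a))

    x-suc≈1 : ∀ i → 1 ≤ℕ i → suc i ≤ℕ n → x i (suc i) ≈ 1#
    x-suc≈1 i 1≤i 1+i≤n = ≡.subst (λ k → x i k ≈ 1#) (ℕₚ.+-comm i 1)
      (x-adjacent≈1 i 1≤i (≡.subst (_≤ℕ n) (ℕₚ.+-comm 1 i) 1+i≤n))

    x-recurrence : ∀ a b → 1 ≤ℕ a → suc (suc a) ≤ℕ b → b ≤ℕ n →
                   x a b ≈ c a * x (suc a) b - x (suc (suc a)) b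
    x-recurrence a b 1≤a 2+a≤b b≤n = x≈y+z⇒z≈x-y (begin
      c a * x (suc a) b
        ≈⟨ plücker a (suc a) (suc (suc a)) b 1≤a (ℕₚ.n≤1+n a) (ℕₚ.n≤1+n (suc a)) 2+a≤b b≤n ⟩
      x a (suc a) * x (suc (suc a)) b + x a b * x (suc a) (suc (suc a))
        ≈⟨ +-cong (trans (*-congʳ (x-suc≈1 a 1≤a 1+a≤n)) (*-identityˡ _))
                  (trans (*-congˡ (x-suc≈1 (suc a) (s≤s z≤n) 2+a≤n)) (*-identityʳ _)) ⟩
      x (suc (suc a)) b + x a b ∎)
      where
      2+a≤n : suc (suc a) ≤ℕ n
      2+a≤n = ℕₚ.≤-trans 2+a≤b b≤n
      1+a≤n : suc a ≤ℕ n
      1+a≤n = ℕₚ.≤-trans (ℕₚ.n≤1+n (suc a)) 2+a≤n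

    x≈continuant : ∀ m a b → a +ℕ suc m ≡ b → 1 ≤ℕ a → b ≤ℕ n → x a b ≈ K R m (λ t → c (a +ℕ toℕ t))
    x≈continuant zero          a b ≡.refl 1≤a b≤n = x-adjacent≈1 a 1≤a b≤n
    x≈continuant (suc zero)    a b ≡.refl 1≤a b≤n = begin
      x a (a +ℕ 2)  ≈⟨ reflexive (≡.cong (x a) (ℕₚ.+-comm a 2)) ⟩
      c a           ≈⟨ reflexive (≡.cong c (≡.sym (ℕₚ.+-identityʳ a))) ⟩
      c (a +ℕ 0)    ≈⟨ sym (K-one (λ t → c (a +ℕ toℕ t))) ⟩
      K R 1 (λ t → c (a +ℕ toℕ t)) ∎
    x≈continuant (suc (suc m)) a b a+m+3≡b 1≤a b≤n = begin
      x a b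
        ≈⟨ x-recurrence a b 1≤a 2+a≤b b≤n ⟩
      c a * x (suc a) b - x (suc (suc a)) b
        ≈⟨ -‿cong₂ (*-congˡ (x≈continuant (suc m) (suc a) b a+m+3≡b′ (s≤s z≤n) b≤n))
                   (x≈continuant m (suc (suc a)) b a+m+3≡b″ (s≤s z≤n) b≤n) ⟩
      c a * K R (suc m) (λ t → c (suc a +ℕ toℕ t)) - K R m (λ t → c (suc (suc a) +ℕ toℕ t))
        ≈⟨ sym (K-recurrence-window m c a) ⟩
      K R (suc (suc m)) (λ t → c (a +ℕ toℕ t)) ∎
      where
      a+m+3≡b′ : suc a +ℕ suc (suc m) ≡ b
      a+m+3≡b′ = ≡.trans (≡.sym (ℕₚ.+-suc a (suc (suc m)))) a+m+3≡b
      a+m+3≡b″ : suc (suc a) +ℕ suc m ≡ b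
      a+m+3≡b″ = ≡.trans (≡.cong suc (≡.sym (ℕₚ.+-suc a (suc m)))) a+m+3≡b′
      2+a≤b : suc (suc a) ≤ℕ b
      2+a≤b = ≡.subst (suc (suc a) ≤ℕ_) a+m+3≡b″ (ℕₚ.m≤m+n (suc (suc a)) (suc m))

-- The hypotheses 3 ≤ n and x i i ≈ 0 are not used: the case j = i is K₁(cᵢ) = cᵢ.
lemma5p6 : ∀ {c ℓ} (R : CommutativeRing c ℓ) → let open CommutativeRing R in
    (n : ℕ) → 3 ≤ℕ n → (x : ℕ → ℕ → Carrier) →
    (∀ i k j l → 1 ≤ℕ i → i ≤ℕ k → k ≤ℕ j → j ≤ℕ l → l ≤ℕ n →
      x i j * x k l ≈ x i k * x j l + x i l * x k j) →
    (∀ i → 1 ≤ℕ i → i ≤ℕ n → x i i ≈ 0#) →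
    (∀ i → 1 ≤ℕ i → i +ℕ 1 ≤ℕ n → x i (i +ℕ 1) ≈ 1#) →
    ∀ i j → i ≤ℕ j → 1 ≤ℕ i ∸ℕ 1 → j +ℕ 1 ≤ℕ n →
      x (i ∸ℕ 1) (j +ℕ 1) ≈ K R (suc (j ∸ℕ i)) (λ t → x ((i +ℕ toℕ t) ∸ℕ 1) ((i +ℕ toℕ t) +ℕ 1))
lemma5p6 R n _ x plücker _ x-adjacent≈1 (suc (suc a)) j i≤j _ j+1≤n =
  trans (PlückerSequence.x≈continuant R n x plücker x-adjacent≈1
           (suc d) (suc a) (j +ℕ 1) a+d+3≡j+1 (s≤s z≤n) j+1≤n)
        (Continuant.K-cong R (suc d) λ t →
          reflexive (≡.cong (x (suc a +ℕ toℕ t)) (ℕₚ.+-comm 1 (suc (suc a) +ℕ toℕ t))))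
  where
  open CommutativeRing R using (trans; reflexive)
  open ≡.≡-Reasoning

  d : ℕ
  d = j ∸ℕ suc (suc a)

  a+d+3≡j+1 : suc a +ℕ suc (suc d) ≡ j +ℕ 1
  a+d+3≡j+1 = begin
    suc a +ℕ suc (suc d)    ≡⟨ ℕₚ.+-suc (suc a) (suc d) ⟩
    suc (suc a +ℕ suc d)    ≡⟨ ≡.cong suc (ℕₚ.+-suc (suc a) d) ⟩
    suc (suc (suc a) +ℕ d)  ≡⟨ ≡.cong suc (ℕₚ.m+[n∸m]≡n i≤j) ⟩
    suc j                   ≡⟨ ℕₚ.+-comm 1 j ⟩
    j +ℕ 1                  ∎
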